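{- (i) $M(1)=2$, $M(2)=5$, and $M(2^r)=7$ for every integer $r\ge 2$. (ii) $M(d)=4$ for every odd integer $d\ge 3$.
   Context: A pair $(a,b)\in\mathbb{Z}^2$ is multiplicatively dependent if $ab\neq 0$ and there is $(k_1,k_2)\in\mathbb{Z}^2\setminus\{(0,0)\}$ with $a^{k_1}b^{k_2}=1$. For $d\in\mathbb{Z}$, $\mathcal{M}(d)$ is the set of multiplicatively dependent pairs $(a,b)\in\mathbb{Z}^2$ with $ab\ne0$ and $b-a=d$, and $M(d)=|\mathcal{M}(d)|$. -}

module Defs where

open import Data.Nat using (ℕ; zero; suc)
open import Data.Integer as ℤ using (ℤ; +_; -[1+_])
open import Data.Rational as ℚ using (ℚ; 0ℚ; 1ℚ; 1/_; ≢-nonZero)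
open import Data.Rational.Properties using (_≟_)
open import Data.Product using (Σ; ∃; _×_; _,_)
open import Data.List using (List; length)
open import Data.List.Membership.Propositional using (_∈_)
open import Data.List.Relation.Unary.Unique.Propositional using (Unique)
open import Function.Bundles using (_⇔_)
open import Relation.Nullary using (¬_; yes; no)
open import Relation.Binary.PropositionalEquality using (_≡_; _≢_)

toℚ : ℤ → ℚ
toℚ a = a ℚ./ 1

powℕ : ℚ → ℕ → ℚ
powℕ x zero    = 1ℚ
powℕ x (suc n) = x ℚ.* powℕ x n

-- multiplicative inverse in ℚ (convention: inverse of 0 is 0; never used
-- on 0 below since a b ≠ 0)
inv : ℚ → ℚ
inv p with p ≟ 0ℚ
... | yes _ = 0ℚ
... | no p≢0 = 1/_ p {{≢-nonZero p≢0}}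

_^ᶻ_ : ℚ → ℤ → ℚ
x ^ᶻ (+ n)    = powℕ x n
x ^ᶻ -[1+ n ] = inv (powℕ x (suc n))

MultDep : ℤ → ℤ → Set
MultDep a b =
  (a ℤ.* b ≢ + 0) ×
  Σ ℤ λ k₁ → Σ ℤ λ k₂ →
    ¬ (k₁ ≡ + 0 × k₂ ≡ + 0) ×
    ((toℚ a ^ᶻ k₁) ℚ.* (toℚ b ^ᶻ k₂) ≡ 1ℚ)

𝓜 : ℤ → ℤ × ℤ → Set
𝓜 d (a , b) = MultDep a b × (a ℤ.* b ≢ + 0) × (b ℤ.- a ≡ d)

HasCard : (ℤ × ℤ → Set) → ℕ → Set
HasCard P n =
  Σ (List (ℤ × ℤ)) λ xs →
    Unique xs × (length xs ≡ n) × (∀ p → (p ∈ xs) ⇔ P p)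

M≡ : ℤ → ℕ → Set
M≡ d n = HasCard (𝓜 d) n

{-# OPTIONS --safe #-}

-- A pair with a b ≠ 0 is multiplicatively dependent iff |a|^m = |b|^n for
-- some (m , n) ≠ (0 , 0); conversely such a relation squared gives
-- a^(2m) b^(-2n) = 1.  So either |a| = 1 or |b| = 1, which for b - a = d
-- gives the four pairs (1 , d + 1), (-1 , d - 1), (1 - d , 1), (-1 - d , -1),
-- or |a|^(p+1) = |b|^(q+1).  In the latter case a prime divides a iff it
-- divides b, so b - a is even and d cannot be odd.  If d = 2^(r+1), every
-- common divisor of |a| and |b| divides d, so a divisor of |a| coprime to 2
-- is coprime to |b| while dividing a power of |b|; hence |a| and |b| are
-- powers of 2, and 2^s + 2^t = 2^u forces s = t, leaving (d , 2d),
-- (-2d , -d) and (-d/2 , d/2).  For d = 1 and d = 2 some of these pairs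
-- vanish or coincide.

module Submission where

open import Defs
open import Data.Nat as ℕ using (ℕ; zero; suc; _+_; _*_; _^_; _<_; z≤n; s≤s) renaming (_≤_ to _≤ℕ_)
import Data.Nat.Properties as ℕP
open import Data.Nat.Divisibility using (divides; _∣?_; ∣-refl; ∣-trans; ∣1⇒≡1; m∣m*n)
  renaming (_∣_ to _∣ₙ_)
open import Data.Nat.Coprimality as Coprimality using (Coprime; coprime-divisor)
open import Data.Nat.Primality
  using (Prime; euclidsLemma; prime[2]; ¬prime[1]; prime⇒irreducible; prime⇒nonTrivial)
open import Data.Nat.Induction using (<-rec)
open import Data.Integer as ℤ using (ℤ; +_; -[1+_]; ∣_∣; 0ℤ; 1ℤ; -1ℤ; _≤_; +≤+)
import Data.Integer.Properties as ℤP
open import Data.Integer.Divisibility using (_∣_)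
import Data.Integer.Divisibility.Signed as ℤ∣
import Data.Integer.DivMod as ℤDivMod
open import Data.Integer.Tactic.RingSolver using (solve-∀)
open import Data.Rational as ℚ using (mkℚ; 0ℚ; 1ℚ; 1/_; ↥_)
import Data.Rational.Properties as ℚP
open import Data.Product using (Σ; ∃; ∃₂; _×_; _,_; proj₁; proj₂)
open import Data.Sum using (_⊎_; inj₁; inj₂)
open import Data.List using (List; []; _∷_; _++_; length)
open import Data.List.Membership.Propositional using (_∈_)
open import Data.List.Membership.Propositional.Properties using (∈-++⁺ˡ; ∈-++⁺ʳ; ∈-++⁻)
open import Data.List.Relation.Unary.Any using (here; there)
open import Data.List.Relation.Unary.All using ([]; _∷_)
open import Data.List.Relation.Unary.AllPairs using ([]; _∷_)
open import Data.List.Relation.Unary.Unique.Propositional using (Unique)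
open import Function.Base using (_∘_)
open import Function.Bundles using (mk⇔)
open import Relation.Nullary using (¬_; yes; no; contradiction)
open import Relation.Binary.PropositionalEquality

coprimeTo-1 : ∀ n → Coprime n 1
coprimeTo-1 n = Coprimality.sym (Coprimality.1-coprimeTo n)

toℚ≡mkℚ : ∀ a → toℚ a ≡ mkℚ a 0 (coprimeTo-1 ∣ a ∣)
toℚ≡mkℚ (+ n)    = ℚP.normalize-coprime (coprimeTo-1 n)
toℚ≡mkℚ -[1+ n ] = cong ℚ.-_ (ℚP.normalize-coprime (coprimeTo-1 (suc n)))

toℚ-* : ∀ a b → toℚ (a ℤ.* b) ≡ toℚ a ℚ.* toℚ b
toℚ-* a b rewrite toℚ≡mkℚ a | toℚ≡mkℚ b = refl

toℚ-injective : ∀ {a b} → toℚ a ≡ toℚ b → a ≡ b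
toℚ-injective {a} {b} eq rewrite toℚ≡mkℚ a | toℚ≡mkℚ b = cong ↥_ eq

toℚ-^ : ∀ a n → toℚ (a ℤ.^ n) ≡ powℕ (toℚ a) n
toℚ-^ a zero    = refl
toℚ-^ a (suc n) = trans (toℚ-* a (a ℤ.^ n)) (cong (toℚ a ℚ.*_) (toℚ-^ a n))

*-inv-self : ∀ {x} → x ≢ 0ℚ → x ℚ.* inv x ≡ 1ℚ
*-inv-self {x} x≢0 with x ℚP.≟ 0ℚ
... | yes x≡0 = contradiction x≡0 x≢0
... | no  x≢0 = ℚP.*-inverseʳ x
  where instance _ = ℚ.≢-nonZero x≢0

*-inv≡1⇒≡ : ∀ x y → x ℚ.* inv y ≡ 1ℚ → x ≡ y
*-inv≡1⇒≡ x y eq with y ℚP.≟ 0ℚ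
... | yes _  = contradiction (trans (sym (ℚP.*-zeroʳ x)) eq) λ ()
... | no y≢0 = begin
  x                  ≡⟨ sym (ℚP.*-identityʳ x) ⟩
  x ℚ.* 1ℚ           ≡⟨ cong (x ℚ.*_) (sym (ℚP.*-inverseˡ y)) ⟩
  x ℚ.* (1/ y ℚ.* y) ≡⟨ sym (ℚP.*-assoc x (1/ y) y) ⟩
  x ℚ.* 1/ y ℚ.* y   ≡⟨ cong (ℚ._* y) eq ⟩
  1ℚ ℚ.* y           ≡⟨ ℚP.*-identityˡ y ⟩
  y                  ∎
  where open ≡-Reasoning
        instance _ = ℚ.≢-nonZero y≢0

inv-*-inv≡1⇒*≡1 : ∀ x y → inv x ℚ.* inv y ≡ 1ℚ → x ℚ.* y ≡ 1ℚ
inv-*-inv≡1⇒*≡1 x y eq with x ℚP.≟ 0ℚ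
... | yes _  = contradiction (trans (sym (ℚP.*-zeroˡ (inv y))) eq) λ ()
... | no x≢0 = trans (cong (x ℚ.*_) (sym (*-inv≡1⇒≡ (1/ x) y eq))) (ℚP.*-inverseʳ x)
  where instance _ = ℚ.≢-nonZero x≢0

^ᶻ-neg : ∀ x n → x ^ᶻ (ℤ.- + n) ≡ inv (powℕ x n)
^ᶻ-neg x zero    = refl
^ᶻ-neg x (suc n) = refl

-- Multiplicative dependence as an equation between powers of |a| and |b|

PowerRelated : ℤ → ℤ → Set
PowerRelated a b = Σ ℕ λ m → Σ ℕ λ n → ¬ (m ≡ 0 × n ≡ 0) × ∣ a ∣ ^ m ≡ ∣ b ∣ ^ n

abs-^ : ∀ a n → ∣ a ℤ.^ n ∣ ≡ ∣ a ∣ ^ n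
abs-^ a zero    = refl
abs-^ a (suc n) = trans (ℤP.abs-* a (a ℤ.^ n)) (cong (∣ a ∣ *_) (abs-^ a n))

powℕ-≡⇒abs-^-≡ : ∀ a b m n → powℕ (toℚ a) m ≡ powℕ (toℚ b) n → ∣ a ∣ ^ m ≡ ∣ b ∣ ^ n
powℕ-≡⇒abs-^-≡ a b m n eq = begin
  ∣ a ∣ ^ m     ≡⟨ abs-^ a m ⟨
  ∣ a ℤ.^ m ∣   ≡⟨ cong ∣_∣ (toℚ-injective {a ℤ.^ m} {b ℤ.^ n}
                               (trans (toℚ-^ a m) (trans eq (sym (toℚ-^ b n))))) ⟩
  ∣ b ℤ.^ n ∣   ≡⟨ abs-^ b n ⟩
  ∣ b ∣ ^ n     ∎
  where open ≡-Reasoning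

powℕ-*≡1⇒abs-^-≡ : ∀ a b m n → powℕ (toℚ a) m ℚ.* powℕ (toℚ b) n ≡ 1ℚ → ∣ a ∣ ^ m ≡ ∣ b ∣ ^ n
powℕ-*≡1⇒abs-^-≡ a b m n eq =
  trans (ℕP.m*n≡1⇒m≡1 (∣ a ∣ ^ m) _ product≡1) (sym (ℕP.m*n≡1⇒n≡1 (∣ a ∣ ^ m) _ product≡1))
  where
  product≡1 : ∣ a ∣ ^ m * ∣ b ∣ ^ n ≡ 1
  product≡1 = begin
    ∣ a ∣ ^ m * ∣ b ∣ ^ n            ≡⟨ cong₂ _*_ (abs-^ a m) (abs-^ b n) ⟨
    ∣ a ℤ.^ m ∣ * ∣ b ℤ.^ n ∣        ≡⟨ ℤP.abs-* (a ℤ.^ m) (b ℤ.^ n) ⟨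
    ∣ a ℤ.^ m ℤ.* b ℤ.^ n ∣          ≡⟨ cong ∣_∣ (toℚ-injective {a ℤ.^ m ℤ.* b ℤ.^ n} {1ℤ} (begin
      toℚ (a ℤ.^ m ℤ.* b ℤ.^ n)            ≡⟨ toℚ-* (a ℤ.^ m) (b ℤ.^ n) ⟩
      toℚ (a ℤ.^ m) ℚ.* toℚ (b ℤ.^ n)      ≡⟨ cong₂ ℚ._*_ (toℚ-^ a m) (toℚ-^ b n) ⟩
      powℕ (toℚ a) m ℚ.* powℕ (toℚ b) n    ≡⟨ eq ⟩
      toℚ 1ℤ                               ∎)) ⟩
    1                                ∎
    where open ≡-Reasoning

multDep⇒powerRelated : ∀ {a b} → MultDep a b → PowerRelated a b
multDep⇒powerRelated {a} {b} (_ , + m , + n , k≢0 , eq) =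
  m , n , (λ (m≡0 , n≡0) → k≢0 (cong +_ m≡0 , cong +_ n≡0)) , powℕ-*≡1⇒abs-^-≡ a b m n eq
multDep⇒powerRelated {a} {b} (_ , + m , -[1+ n ] , _ , eq) =
  m , suc n , (λ ()) , powℕ-≡⇒abs-^-≡ a b m (suc n) (*-inv≡1⇒≡ _ _ eq)
multDep⇒powerRelated {a} {b} (_ , -[1+ m ] , + n , _ , eq) =
  suc m , n , (λ ()) ,
  sym (powℕ-≡⇒abs-^-≡ b a n (suc m) (*-inv≡1⇒≡ _ _ (trans (ℚP.*-comm (powℕ (toℚ b) n) _) eq)))
multDep⇒powerRelated {a} {b} (_ , -[1+ m ] , -[1+ n ] , _ , eq) =
  suc m , suc n , (λ ()) ,
  powℕ-*≡1⇒abs-^-≡ a b (suc m) (suc n) (inv-*-inv≡1⇒*≡1 (powℕ (toℚ a) (suc m)) (powℕ (toℚ b) (suc n)) eq)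

i*i≡+∣i∣*∣i∣ : ∀ i → i ℤ.* i ≡ + (∣ i ∣ * ∣ i ∣)
i*i≡+∣i∣*∣i∣ (+ n)    = sym (ℤP.pos-* n n)
i*i≡+∣i∣*∣i∣ -[1+ n ] = refl

^-double : ∀ a m → a ℤ.^ (m + m) ≡ + (∣ a ∣ ^ m * ∣ a ∣ ^ m)
^-double a m = begin
  a ℤ.^ (m + m)                  ≡⟨ ℤP.^-distribˡ-+-* a m m ⟩
  a ℤ.^ m ℤ.* a ℤ.^ m            ≡⟨ i*i≡+∣i∣*∣i∣ (a ℤ.^ m) ⟩
  + (∣ a ℤ.^ m ∣ * ∣ a ℤ.^ m ∣)  ≡⟨ cong (λ x → + (x * x)) (abs-^ a m) ⟩
  + (∣ a ∣ ^ m * ∣ a ∣ ^ m)      ∎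
  where open ≡-Reasoning

*≢0⇒≢0 : ∀ {a b} → a ℤ.* b ≢ 0ℤ → a ≢ 0ℤ × b ≢ 0ℤ
*≢0⇒≢0 {a} ab≢0 = (λ { refl → ab≢0 refl }) , (λ { refl → ab≢0 (ℤP.*-zeroʳ a) })

*-≢0 : ∀ {a b} → a ≢ 0ℤ → b ≢ 0ℤ → a ℤ.* b ≢ 0ℤ
*-≢0 {a} a≢0 b≢0 ab≡0 with ℤP.i*j≡0⇒i≡0∨j≡0 a ab≡0
... | inj₁ a≡0 = a≢0 a≡0
... | inj₂ b≡0 = b≢0 b≡0

-- Squaring both sides removes the signs: a^(2m) = b^(2n) in ℤ.
powerRelated⇒multDep : ∀ {a b} → a ℤ.* b ≢ 0ℤ → PowerRelated a b → MultDep a b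
powerRelated⇒multDep {a} {b} ab≢0 (m , n , mn≢0 , eq) =
  ab≢0 , + (m + m) , ℤ.- + (n + n) , k≢0 , a²ᵐb⁻²ⁿ≡1
  where
  open ≡-Reasoning
  B = powℕ (toℚ b) (n + n)
  a²ᵐ≡b²ⁿ : powℕ (toℚ a) (m + m) ≡ B
  a²ᵐ≡b²ⁿ = begin
    powℕ (toℚ a) (m + m)                 ≡⟨ toℚ-^ a (m + m) ⟨
    toℚ (a ℤ.^ (m + m))                  ≡⟨ cong toℚ (^-double a m) ⟩
    toℚ (+ (∣ a ∣ ^ m * ∣ a ∣ ^ m))      ≡⟨ cong (λ x → toℚ (+ (x * x))) eq ⟩
    toℚ (+ (∣ b ∣ ^ n * ∣ b ∣ ^ n))      ≡⟨ cong toℚ (^-double b n) ⟨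
    toℚ (b ℤ.^ (n + n))                  ≡⟨ toℚ-^ b (n + n) ⟩
    B                                    ∎
  B≢0 : B ≢ 0ℚ
  B≢0 B≡0 = proj₂ (*≢0⇒≢0 {a} ab≢0)
                  (ℤP.i^n≡0⇒i≡0 b (n + n) (toℚ-injective (trans (toℚ-^ b (n + n)) B≡0)))
  a²ᵐb⁻²ⁿ≡1 : powℕ (toℚ a) (m + m) ℚ.* (toℚ b ^ᶻ (ℤ.- + (n + n))) ≡ 1ℚ
  a²ᵐb⁻²ⁿ≡1 = begin
    powℕ (toℚ a) (m + m) ℚ.* (toℚ b ^ᶻ (ℤ.- + (n + n)))
      ≡⟨ cong₂ ℚ._*_ a²ᵐ≡b²ⁿ (^ᶻ-neg (toℚ b) (n + n)) ⟩
    B ℚ.* inv B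
      ≡⟨ *-inv-self B≢0 ⟩
    1ℚ ∎
  k≢0 : ¬ (+ (m + m) ≡ 0ℤ × ℤ.- + (n + n) ≡ 0ℤ)
  k≢0 (2m≡0 , -2n≡0) = mn≢0 (ℕP.m+n≡0⇒m≡0 m (ℤP.+-injective 2m≡0) ,
                             ℕP.m+n≡0⇒m≡0 n (ℤP.+-injective (ℤP.neg-injective {+ (n + n)} {0ℤ} -2n≡0)))

StrictlyPowerRelated : ℤ → ℤ → Set
StrictlyPowerRelated a b = ∃₂ λ p q → ∣ a ∣ ^ suc p ≡ ∣ b ∣ ^ suc q

powerRelated⇒unit⊎strict : ∀ {a b} → PowerRelated a b →
                           (∣ a ∣ ≡ 1 ⊎ ∣ b ∣ ≡ 1) ⊎ StrictlyPowerRelated a b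
powerRelated⇒unit⊎strict         (zero  , zero  , mn≢0 , _)  = contradiction (refl , refl) mn≢0
powerRelated⇒unit⊎strict {b = b} (zero  , suc q , _    , eq) = inj₁ (inj₂ (ℕP.m*n≡1⇒m≡1 ∣ b ∣ _ (sym eq)))
powerRelated⇒unit⊎strict {a}     (suc p , zero  , _    , eq) = inj₁ (inj₁ (ℕP.m*n≡1⇒m≡1 ∣ a ∣ _ eq))
powerRelated⇒unit⊎strict         (suc p , suc q , _    , eq) = inj₂ (p , q , eq)

prime∣^⇒∣ : ∀ {p x} n → Prime p → p ∣ₙ x ^ n → p ∣ₙ x
prime∣^⇒∣         zero    pp p∣1 = contradiction (subst Prime (∣1⇒≡1 p∣1) pp) ¬prime[1]
prime∣^⇒∣ {x = x} (suc n) pp p∣xxⁿ with euclidsLemma x (x ^ n) pp p∣xxⁿ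
... | inj₁ p∣x  = p∣x
... | inj₂ p∣xⁿ = prime∣^⇒∣ n pp p∣xⁿ

prime∣-^≡^ : ∀ {p x y} m n → Prime p → x ^ suc m ≡ y ^ n → p ∣ₙ x → p ∣ₙ y
prime∣-^≡^ {x = x} m n pp xᵐ⁺¹≡yⁿ p∣x =
  prime∣^⇒∣ n pp (subst (_ ∣ₙ_) xᵐ⁺¹≡yⁿ (∣-trans p∣x (m∣m*n (x ^ m))))

prime∤⇒coprime : ∀ {p n} → Prime p → ¬ p ∣ₙ n → Coprime n p
prime∤⇒coprime pp p∤n (d∣n , d∣p) with prime⇒irreducible pp d∣p
... | inj₁ d≡1 = d≡1
... | inj₂ refl = contradiction d∣n p∤n

coprime∧∣^⇒≡1 : ∀ {u y} n → Coprime u y → u ∣ₙ y ^ n → u ≡ 1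
coprime∧∣^⇒≡1 zero    _       u∣1   = ∣1⇒≡1 u∣1
coprime∧∣^⇒≡1 (suc n) coprime u∣yyⁿ = coprime∧∣^⇒≡1 n coprime (coprime-divisor coprime u∣yyⁿ)

coprime-divisors≡1⇒prime-power : ∀ {p} → Prime p → ∀ x → x ≢ 0 →
                                  (∀ {u} → u ∣ₙ x → Coprime u p → u ≡ 1) → ∃ λ s → x ≡ p ^ s
coprime-divisors≡1⇒prime-power {p} pp = <-rec _ step
  where
  instance _ = prime⇒nonTrivial pp
  P : ℕ → Set
  P x = x ≢ 0 → (∀ {u} → u ∣ₙ x → Coprime u p → u ≡ 1) → ∃ λ s → x ≡ p ^ s
  step : ∀ x → (∀ {y} → y < x → P y) → P x
  step x rec x≢0 trivial with p ∣? x
  ... | no  p∤x = 0 , trivial ∣-refl (prime∤⇒coprime pp p∤x)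
  ... | yes (divides y refl) with rec y<yp y≢0 (λ u∣y → trivial (∣-trans u∣y (m∣m*n p)))
    where
    y≢0 : y ≢ 0
    y≢0 refl = x≢0 refl
    y<yp : y < y * p
    y<yp = ℕP.m<m*n y p {{ℕ.≢-nonZero y≢0}} (ℕ.nonTrivial⇒n>1 p)
  ...   | s , refl = suc s , ℕP.*-comm (p ^ s) p

common-power⇒prime-power : ∀ {p x y} r m n → Prime p → x ≢ 0 → x ^ suc m ≡ y ^ n →
                           (∀ {g} → g ∣ₙ x → g ∣ₙ y → g ∣ₙ p ^ r) → ∃ λ s → x ≡ p ^ s
common-power⇒prime-power {p} {x} {y} r m n pp x≢0 xᵐ⁺¹≡yⁿ common =
  coprime-divisors≡1⇒prime-power pp x x≢0 λ {u} u∣x u⊥p →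
    let u⊥y : Coprime u y
        u⊥y (g∣u , g∣y) = coprime∧∣^⇒≡1 r (λ (h∣g , h∣p) → u⊥p (∣-trans h∣g g∣u , h∣p))
                                          (common (∣-trans g∣u u∣x) g∣y)
    in coprime∧∣^⇒≡1 n u⊥y (subst (u ∣ₙ_) xᵐ⁺¹≡yⁿ (∣-trans u∣x (m∣m*n (x ^ m))))

b-a≡d⇒b≡d+a : ∀ a b {d} → b ℤ.- a ≡ d → b ≡ d ℤ.+ a
b-a≡d⇒b≡d+a a b refl = b≡[b-a]+a a b
  where b≡[b-a]+a : ∀ a b → b ≡ (b ℤ.- a) ℤ.+ a
        b≡[b-a]+a = solve-∀

b-a≡d⇒a≡b-d : ∀ a b {d} → b ℤ.- a ≡ d → a ≡ b ℤ.- d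
b-a≡d⇒a≡b-d a b refl = a≡b-[b-a] a b
  where a≡b-[b-a] : ∀ a b → a ≡ b ℤ.- (b ℤ.- a)
        a≡b-[b-a] = solve-∀

+[2*n]≡+n++n : ∀ n → + (2 * n) ≡ + n ℤ.+ + n
+[2*n]≡+n++n n = cong (λ m → + (n + m)) (ℕP.+-identityʳ n)

d+x-x≡d : ∀ d x → (d ℤ.+ x) ℤ.- x ≡ d
d+x-x≡d = solve-∀

x-[x-d]≡d : ∀ d x → x ℤ.- (x ℤ.- d) ≡ d
x-[x-d]≡d = solve-∀

x+x-x≡x : ∀ x → (x ℤ.+ x) ℤ.- x ≡ x
x+x-x≡x = solve-∀

-x--[x+x]≡x : ∀ x → ℤ.- x ℤ.- ℤ.- (x ℤ.+ x) ≡ x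
-x--[x+x]≡x = solve-∀

x--y≡x+y : ∀ x y → x ℤ.- ℤ.- y ≡ x ℤ.+ y
x--y≡x+y = solve-∀

-x-y≡-[x+y] : ∀ x y → ℤ.- x ℤ.- y ≡ ℤ.- (x ℤ.+ y)
-x-y≡-[x+y] = solve-∀

∣∣⇒∣-difference : ∀ {a b n g} → b ℤ.- a ≡ + n → g ∣ₙ ∣ a ∣ → g ∣ₙ ∣ b ∣ → g ∣ₙ n
∣∣⇒∣-difference {a} {b} {g = g} b-a≡n g∣a g∣b = subst (g ∣ₙ_) (cong ∣_∣ b-a≡n)
  (ℤ∣.∣⇒∣ᵤ {+ g} {b ℤ.- a} (ℤ∣.∣m∣n⇒∣m-n (ℤ∣.∣ᵤ⇒∣ {+ g} {b} g∣b) (ℤ∣.∣ᵤ⇒∣ {+ g} {a} g∣a)))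

odd⇒≡1+[a/2]*2 : ∀ a → ¬ + 2 ∣ a → a ≡ 1ℤ ℤ.+ (a ℤ./ + 2) ℤ.* + 2
odd⇒≡1+[a/2]*2 a 2∤a with a ℤ.% + 2 | ℤDivMod.a≡a%n+[a/n]*n a (+ 2) | ℤDivMod.n%d<d a (+ 2)
... | 0           | a≡[a/2]*2   | _ = contradiction
  (ℤ∣.∣⇒∣ᵤ {+ 2} {a} (ℤ∣.divides (a ℤ./ + 2) (trans a≡[a/2]*2 (ℤP.+-identityˡ _)))) 2∤a
... | 1           | a≡1+[a/2]*2 | _ = a≡1+[a/2]*2
... | suc (suc _) | _           | s≤s (s≤s ())

2∤∧2∤⇒2∣difference : ∀ {a b} → ¬ + 2 ∣ a → ¬ + 2 ∣ b → + 2 ∣ b ℤ.- a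
2∤∧2∤⇒2∣difference {a} {b} 2∤a 2∤b = ℤ∣.∣⇒∣ᵤ {+ 2} {b ℤ.- a} (ℤ∣.divides (b ℤ./ + 2 ℤ.- a ℤ./ + 2)
  (trans (cong₂ ℤ._-_ (odd⇒≡1+[a/2]*2 b 2∤b) (odd⇒≡1+[a/2]*2 a 2∤a)) (difference (b ℤ./ + 2) (a ℤ./ + 2))))
  where difference : ∀ x y → (1ℤ ℤ.+ x ℤ.* + 2) ℤ.- (1ℤ ℤ.+ y ℤ.* + 2) ≡ (x ℤ.- y) ℤ.* + 2
        difference = solve-∀

-- 2 divides a iff it divides b, so b - a is even.
strictlyPowerRelated⇒2∣difference : ∀ {a b} → StrictlyPowerRelated a b → + 2 ∣ b ℤ.- a
strictlyPowerRelated⇒2∣difference {a} {b} (p , q , eq) with 2 ∣? ∣ a ∣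
... | yes 2∣a = ℤ∣.∣⇒∣ᵤ {+ 2} {b ℤ.- a} (ℤ∣.∣m∣n⇒∣m-n (ℤ∣.∣ᵤ⇒∣ {+ 2} {b} 2∣b) (ℤ∣.∣ᵤ⇒∣ {+ 2} {a} 2∣a))
  where 2∣b : 2 ∣ₙ ∣ b ∣
        2∣b = prime∣-^≡^ p (suc q) prime[2] eq 2∣a
... | no  2∤a = 2∤∧2∤⇒2∣difference {a} {b} 2∤a (λ 2∣b → 2∤a (prime∣-^≡^ q (suc p) prime[2] (sym eq) 2∣b))

2^≢0 : ∀ n → 2 ^ n ≢ 0
2^≢0 n = ℕ.≢-nonZero⁻¹ (2 ^ n) {{ℕP.m^n≢0 2 n}}

+2^≢0 : ∀ n → + (2 ^ n) ≢ 0ℤ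
+2^≢0 n = 2^≢0 n ∘ ℤP.+-injective

-+2^≢0 : ∀ n → ℤ.- + (2 ^ n) ≢ 0ℤ
-+2^≢0 n = +2^≢0 n ∘ ℤP.neg-injective {+ (2 ^ n)} {0ℤ}

2^-^-comm : ∀ m n → (2 ^ m) ^ n ≡ (2 ^ n) ^ m
2^-^-comm m n = begin
  (2 ^ m) ^ n  ≡⟨ ℕP.^-*-assoc 2 m n ⟩
  2 ^ (m * n)  ≡⟨ cong (2 ^_) (ℕP.*-comm m n) ⟩
  2 ^ (n * m)  ≡⟨ ℕP.^-*-assoc 2 n m ⟨
  (2 ^ n) ^ m  ∎
  where open ≡-Reasoning

2^+2^≡2^⇒ : ∀ m n o → 2 ^ m + 2 ^ n ≡ 2 ^ o → m ≡ n × o ≡ suc m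
2^+2^≡2^⇒ zero    zero    zero          ()
2^+2^≡2^⇒ zero    zero    (suc zero)    _ = refl , refl
2^+2^≡2^⇒ zero    zero    (suc (suc o)) e =
  contradiction (sym (ℕP.*-cancelˡ-≡ 1 (2 * 2 ^ o) 2 e)) (ℕP.even≢odd (2 ^ o) 0)
2^+2^≡2^⇒ zero    (suc n) zero          e = contradiction (ℕP.suc-injective e) (2^≢0 (suc n))
2^+2^≡2^⇒ zero    (suc n) (suc o)       e = contradiction (sym e) (ℕP.even≢odd (2 ^ o) (2 ^ n))
2^+2^≡2^⇒ (suc m) zero    zero          e =
  contradiction (ℕP.suc-injective (trans (ℕP.+-comm 1 (2 ^ suc m)) e)) (2^≢0 (suc m))
2^+2^≡2^⇒ (suc m) zero    (suc o)       e =
  contradiction (sym (trans (ℕP.+-comm 1 (2 ^ suc m)) e)) (ℕP.even≢odd (2 ^ o) (2 ^ m))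
2^+2^≡2^⇒ (suc m) (suc n) zero          e =
  contradiction (trans (ℕP.*-distribˡ-+ 2 (2 ^ m) (2 ^ n)) e) (ℕP.even≢odd (2 ^ m + 2 ^ n) 0)
2^+2^≡2^⇒ (suc m) (suc n) (suc o)       e
  with 2^+2^≡2^⇒ m n o
         (ℕP.*-cancelˡ-≡ (2 ^ m + 2 ^ n) (2 ^ o) 2 (trans (ℕP.*-distribˡ-+ 2 (2 ^ m) (2 ^ n)) e))
... | refl , refl = refl , refl

∣i∣≡n⇒i≡±n : ∀ {i n} → ∣ i ∣ ≡ n → i ≡ + n ⊎ i ≡ ℤ.- + n
∣i∣≡n⇒i≡±n {+ _}      refl = inj₁ refl
∣i∣≡n⇒i≡±n { -[1+ _ ]} refl = inj₂ refl

-+m≡+n⇒m≡0 : ∀ {m n} → ℤ.- + m ≡ + n → m ≡ 0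
-+m≡+n⇒m≡0 {zero} _ = refl

-- Meant for d = 2h and e = 2d, which are separate arguments so that they
-- can be given convenient normal forms.
doublingPairs : ℕ → ℕ → ℕ → List (ℤ × ℤ)
doublingPairs h d e = (+ d , + e) ∷ (ℤ.- + e , ℤ.- + d) ∷ (ℤ.- + h , + h) ∷ []

powersOfTwo⇒doublingPair : ∀ {a b} r s t → ∣ a ∣ ≡ 2 ^ s → ∣ b ∣ ≡ 2 ^ t → b ℤ.- a ≡ + (2 ^ suc r) →
                           (a , b) ∈ doublingPairs (2 ^ r) (2 ^ suc r) (2 ^ suc (suc r))
powersOfTwo⇒doublingPair {a} {b} r s t ∣a∣≡2ˢ ∣b∣≡2ᵗ b-a≡2ʳ⁺¹
  with ∣i∣≡n⇒i≡±n {a} ∣a∣≡2ˢ | ∣i∣≡n⇒i≡±n {b} ∣b∣≡2ᵗ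
... | inj₁ refl | inj₁ refl
  with 2^+2^≡2^⇒ (suc r) s t (ℤP.+-injective (sym (b-a≡d⇒b≡d+a (+ (2 ^ s)) (+ (2 ^ t)) b-a≡2ʳ⁺¹)))
...   | refl , refl = here refl
powersOfTwo⇒doublingPair r s t _ _ b-a≡2ʳ⁺¹ | inj₂ refl | inj₂ refl
  with 2^+2^≡2^⇒ t (suc r) s (sym (ℤP.+-injective (ℤP.neg-injective (trans
         (b-a≡d⇒a≡b-d (ℤ.- + (2 ^ s)) (ℤ.- + (2 ^ t)) b-a≡2ʳ⁺¹)
         (-x-y≡-[x+y] (+ (2 ^ t)) (+ (2 ^ suc r)))))))
...   | refl , refl = there (here refl)
powersOfTwo⇒doublingPair r s t _ _ b-a≡2ʳ⁺¹ | inj₂ refl | inj₁ refl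
  with 2^+2^≡2^⇒ t s (suc r) (ℤP.+-injective (trans (sym (x--y≡x+y (+ (2 ^ t)) (+ (2 ^ s)))) b-a≡2ʳ⁺¹))
...   | refl , refl = there (there (here refl))
powersOfTwo⇒doublingPair r s t _ _ b-a≡2ʳ⁺¹ | inj₁ refl | inj₂ refl = contradiction
  (ℕP.m+n≡0⇒m≡0 (2 ^ t) (-+m≡+n⇒m≡0 (trans (sym (-x-y≡-[x+y] (+ (2 ^ t)) (+ (2 ^ s)))) b-a≡2ʳ⁺¹)))
  (2^≢0 t)

strictlyPowerRelated⇒doublingPair : ∀ {a b} r → a ℤ.* b ≢ 0ℤ → b ℤ.- a ≡ + (2 ^ suc r) →
                                    StrictlyPowerRelated a b →
                                    (a , b) ∈ doublingPairs (2 ^ r) (2 ^ suc r) (2 ^ suc (suc r))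
strictlyPowerRelated⇒doublingPair {a} {b} r ab≢0 b-a≡2ʳ⁺¹ (p , q , eq)
  with common-power⇒prime-power (suc r) p (suc q) prime[2] (∣≢0 (proj₁ (*≢0⇒≢0 {a} ab≢0))) eq common
     | common-power⇒prime-power (suc r) q (suc p) prime[2] (∣≢0 (proj₂ (*≢0⇒≢0 {a} ab≢0))) (sym eq)
                                (λ g∣b g∣a → common g∣a g∣b)
  where
  common : ∀ {g} → g ∣ₙ ∣ a ∣ → g ∣ₙ ∣ b ∣ → g ∣ₙ 2 ^ suc r
  common = ∣∣⇒∣-difference {a} {b} b-a≡2ʳ⁺¹
  ∣≢0 : ∀ {i} → i ≢ 0ℤ → ∣ i ∣ ≢ 0
  ∣≢0 i≢0 ∣i∣≡0 = i≢0 (ℤP.∣i∣≡0⇒i≡0 ∣i∣≡0)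
... | s , ∣a∣≡2ˢ | t , ∣b∣≡2ᵗ = powersOfTwo⇒doublingPair r s t ∣a∣≡2ˢ ∣b∣≡2ᵗ b-a≡2ʳ⁺¹

𝓜-intro : ∀ {a b d} → a ℤ.* b ≢ 0ℤ → PowerRelated a b → b ℤ.- a ≡ d → 𝓜 d (a , b)
𝓜-intro {a} {b} ab≢0 related b-a≡d = powerRelated⇒multDep {a} {b} ab≢0 related , ab≢0 , b-a≡d

unitPairs : ℤ → List (ℤ × ℤ)
unitPairs d = (1ℤ , d ℤ.+ 1ℤ) ∷ (-1ℤ , d ℤ.+ -1ℤ) ∷ (1ℤ ℤ.- d , 1ℤ) ∷ (-1ℤ ℤ.- d , -1ℤ) ∷ []

unit⇒unitPair : ∀ {a b d} → b ℤ.- a ≡ d → ∣ a ∣ ≡ 1 ⊎ ∣ b ∣ ≡ 1 → (a , b) ∈ unitPairs d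
unit⇒unitPair {a} {b} b-a≡d (inj₁ ∣a∣≡1) with ∣i∣≡n⇒i≡±n {a} ∣a∣≡1
... | inj₁ refl = here (cong (1ℤ ,_) (b-a≡d⇒b≡d+a 1ℤ b b-a≡d))
... | inj₂ refl = there (here (cong (-1ℤ ,_) (b-a≡d⇒b≡d+a -1ℤ b b-a≡d)))
unit⇒unitPair {a} {b} b-a≡d (inj₂ ∣b∣≡1) with ∣i∣≡n⇒i≡±n {b} ∣b∣≡1
... | inj₁ refl = there (there (here (cong (_, 1ℤ) (b-a≡d⇒a≡b-d a 1ℤ b-a≡d))))
... | inj₂ refl = there (there (there (here (cong (_, -1ℤ) (b-a≡d⇒a≡b-d a -1ℤ b-a≡d)))))

unitPair⇒𝓜 : ∀ {a b d} → a ℤ.* b ≢ 0ℤ → (a , b) ∈ unitPairs d → 𝓜 d (a , b)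
unitPair⇒𝓜 {a} {b} {d} ab≢0 (here refl)                         =
  𝓜-intro {a} {b} ab≢0 (1 , 0 , (λ { (() , _) }) , refl) (d+x-x≡d d 1ℤ)
unitPair⇒𝓜 {a} {b} {d} ab≢0 (there (here refl))                 =
  𝓜-intro {a} {b} ab≢0 (1 , 0 , (λ { (() , _) }) , refl) (d+x-x≡d d -1ℤ)
unitPair⇒𝓜 {a} {b} {d} ab≢0 (there (there (here refl)))         =
  𝓜-intro {a} {b} ab≢0 (0 , 1 , (λ { (_ , ()) }) , refl) (x-[x-d]≡d d 1ℤ)
unitPair⇒𝓜 {a} {b} {d} ab≢0 (there (there (there (here refl)))) =
  𝓜-intro {a} {b} ab≢0 (0 , 1 , (λ { (_ , ()) }) , refl) (x-[x-d]≡d d -1ℤ)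

unitPair-nonzero : ∀ {a b d} → + 2 ≤ d → (a , b) ∈ unitPairs d → a ℤ.* b ≢ 0ℤ
unitPair-nonzero (+≤+ (s≤s (s≤s z≤n))) (here refl)                         = λ ()
unitPair-nonzero (+≤+ (s≤s (s≤s z≤n))) (there (here refl))                 = λ ()
unitPair-nonzero (+≤+ (s≤s (s≤s z≤n))) (there (there (here refl)))         = λ ()
unitPair-nonzero (+≤+ (s≤s (s≤s z≤n))) (there (there (there (here refl)))) = λ ()

𝓜⇒unitPair⊎strict : ∀ {a b d} → 𝓜 d (a , b) → (a , b) ∈ unitPairs d ⊎ StrictlyPowerRelated a b
𝓜⇒unitPair⊎strict {a} {b} (dependent , _ , b-a≡d)
  with powerRelated⇒unit⊎strict {a} {b} (multDep⇒powerRelated {a} {b} dependent)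
... | inj₁ unit   = inj₁ (unit⇒unitPair b-a≡d unit)
... | inj₂ strict = inj₂ strict

doublingPair⇒𝓜 : ∀ {a b} r → (a , b) ∈ doublingPairs (2 ^ r) (2 ^ suc r) (2 ^ suc (suc r)) →
                 𝓜 (+ (2 ^ suc r)) (a , b)
doublingPair⇒𝓜 {a} {b} r (here refl) =
  𝓜-intro {a} {b} (*-≢0 (+2^≢0 (suc r)) (+2^≢0 (suc (suc r))))
    (suc (suc r) , suc r , (λ { (() , _) }) , 2^-^-comm (suc r) (suc (suc r)))
    (trans (cong (ℤ._- + (2 ^ suc r)) (+[2*n]≡+n++n (2 ^ suc r))) (x+x-x≡x (+ (2 ^ suc r))))
doublingPair⇒𝓜 {a} {b} r (there (here refl)) =
  𝓜-intro {a} {b} (*-≢0 (-+2^≢0 (suc (suc r))) (-+2^≢0 (suc r)))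
    (suc r , suc (suc r) , (λ { (() , _) }) ,
     trans (cong (_^ suc r) (ℤP.∣-i∣≡∣i∣ (+ (2 ^ suc (suc r)))))
           (trans (2^-^-comm (suc (suc r)) (suc r))
                  (cong (_^ suc (suc r)) (sym (ℤP.∣-i∣≡∣i∣ (+ (2 ^ suc r)))))))
    (trans (cong (λ x → ℤ.- + (2 ^ suc r) ℤ.- ℤ.- x) (+[2*n]≡+n++n (2 ^ suc r)))
           (-x--[x+x]≡x (+ (2 ^ suc r))))
doublingPair⇒𝓜 {a} {b} r (there (there (here refl))) =
  𝓜-intro {a} {b} (*-≢0 (-+2^≢0 r) (+2^≢0 r))
    (1 , 1 , (λ { (() , _) }) , cong (_* 1) (ℤP.∣-i∣≡∣i∣ (+ (2 ^ r))))
    (trans (x--y≡x+y (+ (2 ^ r)) (+ (2 ^ r))) (sym (+[2*n]≡+n++n (2 ^ r))))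

𝓜[odd]⊆unitPairs : ∀ {a b d} → ¬ + 2 ∣ d → 𝓜 d (a , b) → (a , b) ∈ unitPairs d
𝓜[odd]⊆unitPairs {a} {b} 2∤d m@(_ , _ , b-a≡d) with 𝓜⇒unitPair⊎strict {a} {b} m
... | inj₁ unit   = unit
... | inj₂ strict =
  contradiction (subst (+ 2 ∣_) b-a≡d (strictlyPowerRelated⇒2∣difference {a} {b} strict)) 2∤d

unitPairs⊆𝓜 : ∀ {a b d} → + 2 ≤ d → (a , b) ∈ unitPairs d → 𝓜 d (a , b)
unitPairs⊆𝓜 2≤d unit = unitPair⇒𝓜 (unitPair-nonzero 2≤d unit) unit

2≤2^suc : ∀ n → 2 ≤ℕ 2 ^ suc n
2≤2^suc n = ℕP.*-monoʳ-≤ 2 (ℕP.m^n>0 2 n)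

powerOfTwoPairs : ℕ → List (ℤ × ℤ)
powerOfTwoPairs r = unitPairs (+ (2 ^ suc r)) ++ doublingPairs (2 ^ r) (2 ^ suc r) (2 ^ suc (suc r))

𝓜[2^[1+r]]⊆powerOfTwoPairs : ∀ {a b} r → 𝓜 (+ (2 ^ suc r)) (a , b) → (a , b) ∈ powerOfTwoPairs r
𝓜[2^[1+r]]⊆powerOfTwoPairs {a} {b} r m@(_ , ab≢0 , b-a≡d) with 𝓜⇒unitPair⊎strict {a} {b} m
... | inj₁ unit   = ∈-++⁺ˡ unit
... | inj₂ strict = ∈-++⁺ʳ (unitPairs (+ (2 ^ suc r)))
                           (strictlyPowerRelated⇒doublingPair {a} {b} r ab≢0 b-a≡d strict)

powerOfTwoPairs⊆𝓜[2^[1+r]] : ∀ {a b} r → (a , b) ∈ powerOfTwoPairs r → 𝓜 (+ (2 ^ suc r)) (a , b)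
powerOfTwoPairs⊆𝓜[2^[1+r]] r p∈ with ∈-++⁻ (unitPairs (+ (2 ^ suc r))) p∈
... | inj₁ unit     = unitPairs⊆𝓜 (+≤+ (2≤2^suc r)) unit
... | inj₂ doubling = doublingPair⇒𝓜 r doubling

M≡-intro : ∀ {d} xs → Unique xs → (∀ {a b} → (a , b) ∈ xs → 𝓜 d (a , b)) →
           (∀ {a b} → 𝓜 d (a , b) → (a , b) ∈ xs) → M≡ d (length xs)
M≡-intro xs unique sound complete = xs , unique , refl , λ _ → mk⇔ sound complete

M[1]≡2 : M≡ (+ 1) 2
M[1]≡2 = M≡-intro pairs (((λ ()) ∷ []) ∷ [] ∷ []) sound complete
  where
  pairs : List (ℤ × ℤ)
  pairs = (1ℤ , + 2) ∷ (-[1+ 1 ] , -1ℤ) ∷ []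
  sound : ∀ {a b} → (a , b) ∈ pairs → 𝓜 (+ 1) (a , b)
  sound (here refl)         = unitPair⇒𝓜 (λ ()) (here refl)
  sound (there (here refl)) = unitPair⇒𝓜 (λ ()) (there (there (there (here refl))))
  complete : ∀ {a b} → 𝓜 (+ 1) (a , b) → (a , b) ∈ pairs
  complete {a} {b} m@(_ , ab≢0 , _)
    with 𝓜[odd]⊆unitPairs {a} {b} (λ 2∣1 → contradiction (∣1⇒≡1 2∣1) λ ()) m
  ... | here refl                         = here refl
  ... | there (here refl)                 = contradiction refl ab≢0
  ... | there (there (here refl))         = contradiction refl ab≢0
  ... | there (there (there (here refl))) = there (here refl)

M[2]≡5 : M≡ (+ 2) 5
M[2]≡5 = M≡-intro pairs unique sound complete
  where
  pairs : List (ℤ × ℤ)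
  pairs = (1ℤ , + 3) ∷ (-[1+ 2 ] , -1ℤ) ∷ doublingPairs 1 2 4
  unique : Unique pairs
  unique = ((λ ()) ∷ (λ ()) ∷ (λ ()) ∷ (λ ()) ∷ []) ∷ ((λ ()) ∷ (λ ()) ∷ (λ ()) ∷ [])
         ∷ ((λ ()) ∷ (λ ()) ∷ []) ∷ ((λ ()) ∷ []) ∷ [] ∷ []
  sound : ∀ {a b} → (a , b) ∈ pairs → 𝓜 (+ 2) (a , b)
  sound (here refl)         = powerOfTwoPairs⊆𝓜[2^[1+r]] 0 (here refl)
  sound (there (here refl)) = powerOfTwoPairs⊆𝓜[2^[1+r]] 0 (there (there (there (here refl))))
  sound (there (there p∈))  = powerOfTwoPairs⊆𝓜[2^[1+r]] 0 (there (there (there (there p∈))))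
  complete : ∀ {a b} → 𝓜 (+ 2) (a , b) → (a , b) ∈ pairs
  complete {a} {b} m with 𝓜[2^[1+r]]⊆powerOfTwoPairs {a} {b} 0 m
  ... | here refl                           = here refl
  ... | there (here refl)                   = there (there (there (there (here refl))))
  ... | there (there (here refl))           = there (there (there (there (here refl))))
  ... | there (there (there (here refl)))   = there (here refl)
  ... | there (there (there (there p∈)))    = there (there p∈)

-- h * 2 and h * 4 are 4 + n * 2 and 8 + n * 4 by computation, so that
-- all 21 inequalities of the table are refuted by λ ().
unitPairs++doublingPairs-unique : ∀ h → 2 ≤ℕ h →
  Unique (unitPairs (+ (2 * h)) ++ doublingPairs h (2 * h) (2 * (2 * h)))
unitPairs++doublingPairs-unique h@(suc (suc n)) (s≤s (s≤s z≤n)) =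
  subst₂ (λ d e → Unique (unitPairs (+ d) ++ doublingPairs h d e))
         (ℕP.*-comm h 2) (trans (ℕP.*-comm h 4) (ℕP.*-assoc 2 2 h)) table
  where
  table : Unique (unitPairs (+ (h * 2)) ++ doublingPairs h (h * 2) (h * 4))
  table = ((λ ()) ∷ (λ ()) ∷ (λ ()) ∷ (λ ()) ∷ (λ ()) ∷ (λ ()) ∷ [])
        ∷ ((λ ()) ∷ (λ ()) ∷ (λ ()) ∷ (λ ()) ∷ (λ ()) ∷ [])
        ∷ ((λ ()) ∷ (λ ()) ∷ (λ ()) ∷ (λ ()) ∷ [])
        ∷ ((λ ()) ∷ (λ ()) ∷ (λ ()) ∷ [])
        ∷ ((λ ()) ∷ (λ ()) ∷ [])
        ∷ ((λ ()) ∷ [])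
        ∷ [] ∷ []

M[2^[2+r]]≡7 : ∀ r → M≡ (+ (2 ^ (2 + r))) 7
M[2^[2+r]]≡7 r = M≡-intro (powerOfTwoPairs (suc r))
  (unitPairs++doublingPairs-unique (2 ^ suc r) (2≤2^suc r))
  (powerOfTwoPairs⊆𝓜[2^[1+r]] (suc r)) (𝓜[2^[1+r]]⊆powerOfTwoPairs (suc r))

unitPairs-unique : ∀ {d} → + 3 ≤ d → Unique (unitPairs d)
unitPairs-unique (+≤+ (s≤s (s≤s (s≤s z≤n)))) =
  ((λ ()) ∷ (λ ()) ∷ (λ ()) ∷ []) ∷ ((λ ()) ∷ (λ ()) ∷ []) ∷ ((λ ()) ∷ []) ∷ [] ∷ []

M[odd]≡4 : ∀ d → ¬ + 2 ∣ d → + 3 ≤ d → M≡ d 4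
M[odd]≡4 d 2∤d 3≤d = M≡-intro (unitPairs d) (unitPairs-unique 3≤d)
  (unitPairs⊆𝓜 (ℤP.≤-trans (+≤+ (ℕP.n≤1+n 2)) 3≤d)) (𝓜[odd]⊆unitPairs 2∤d)

theorem4p2 : (M≡ (+ 1) 2 × M≡ (+ 2) 5 × (∀ (r : ℕ) → 2 ≤ℕ r → M≡ (+ (2 ^ r)) 7))
    × (∀ (d : ℤ) → ¬ ((+ 2) ∣ d) → + 3 ≤ d → M≡ d 4)
theorem4p2 = (M[1]≡2 , M[2]≡5 , M[2^r]≡7) , M[odd]≡4
  where
  M[2^r]≡7 : ∀ r → 2 ≤ℕ r → M≡ (+ (2 ^ r)) 7
  M[2^r]≡7 (suc (suc r)) (s≤s (s≤s z≤n)) = M[2^[2+r]]≡7 r
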